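{- Let $n \geq 1$, $G := \mathbb{F}_2^n$, let $A \subset G$ have density $\alpha := |A|/|G| > 0$, and let $V \leq G$ be a non-zero subspace. Then there is a subspace $V' \leq V$ of co-dimension $1$ in $V$ such that \[ \mathbb{P}_{V'}\big(V' \setminus (A+A)\big) \leq \frac{1-2\alpha}{1-\alpha}\, \mathbb{P}_V\big(V \setminus (A+A)\big). \]
   Context: $A+A := \{a+a' : a,a' \in A\}$. For a subspace $W$ and $X\subset W$, $\mathbb{P}_W(X) := |X|/|W|$. -}

module Defs where

open import Data.Bool using (Bool; true; false; _xor_; _∧_; _∨_; if_then_else_; not)
open import Data.Bool.Properties using () renaming (_≟_ to _≟B_)
open import Data.Nat using (ℕ; zero; suc; _+_)
open import Data.Vec using (Vec; []; _∷_; zipWith; replicate; foldr)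
open import Data.Vec.Properties using (≡-dec)
open import Data.List using (List; []; _∷_; map; _++_)
open import Data.Product using (Σ; _×_; ∃)
open import Relation.Binary.PropositionalEquality using (_≡_)
open import Relation.Nullary.Decidable using (⌊_⌋)

G : ℕ → Set
G n = Vec Bool n

_⊕_ : ∀ {n} → G n → G n → G n
_⊕_ = zipWith _xor_

0G : ∀ {n} → G n
0G = replicate _ false

_==_ : ∀ {n} → G n → G n → Bool
x == y = ⌊ ≡-dec _≟B_ x y ⌋

allG : (n : ℕ) → List (G n)
allG zero = [] ∷ []
allG (suc n) = map (false ∷_) (allG n) ++ map (true ∷_) (allG n)

SubsetG : ℕ → Set
SubsetG n = G n → Bool

anyL : ∀ {n} → (G n → Bool) → List (G n) → Bool
anyL p [] = false
anyL p (x ∷ xs) = p x ∨ anyL p xs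

countL : ∀ {n} → (G n → Bool) → List (G n) → ℕ
countL p [] = 0
countL p (x ∷ xs) = (if p x then 1 else 0) + countL p xs

card : ∀ {n} → SubsetG n → ℕ
card {n} X = countL X (allG n)

_∈_ : ∀ {n} → G n → SubsetG n → Set
x ∈ X = X x ≡ true

_⊆_ : ∀ {n} → SubsetG n → SubsetG n → Set
X ⊆ Y = ∀ x → x ∈ X → x ∈ Y

sumset : ∀ {n} → SubsetG n → SubsetG n
sumset {n} A x = anyL (λ a → anyL (λ a' → A a ∧ A a' ∧ ((a ⊕ a') == x)) (allG n)) (allG n)

_∖_ : ∀ {n} → SubsetG n → SubsetG n → SubsetG n
(X ∖ Y) x = X x ∧ not (Y x)

-- subspace of F_2^n: contains 0 and closed under addition
-- (scalar multiplication over F_2 is automatic)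
IsSubspace : ∀ {n} → SubsetG n → Set
IsSubspace {n} W = (0G ∈ W) × (∀ x y → x ∈ W → y ∈ W → (x ⊕ y) ∈ W)

NonZero : ∀ {n} → SubsetG n → Set
NonZero {n} W = Σ (G n) λ x → (x ∈ W) × (Data.Bool.T (not (x == 0G)))

lincomb : ∀ {n d} → Vec Bool d → Vec (G n) d → G n
lincomb [] [] = 0G
lincomb (c ∷ cs) (b ∷ bs) = (if c then b else 0G) ⊕ lincomb cs bs

HasDim : ∀ {n} → SubsetG n → ℕ → Set
HasDim {n} W d = Σ (Vec (G n) d) λ B →
    (∀ c → lincomb c B ≡ 0G → c ≡ replicate d false)
  × (∀ x → x ∈ W → Σ (Vec Bool d) λ c → lincomb c B ≡ x)
  × (∀ c → lincomb c B ∈ W)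

CodimOneIn : ∀ {n} → SubsetG n → SubsetG n → Set
CodimOneIn V' V = IsSubspace V' × (V' ⊆ V) × Σ ℕ λ d → HasDim V (suc d) × HasDim V' d

module Submission where

-- Write N = 2ⁿ, a = |A|, T = V ∖ (A + A), t = |T|, and for γ ∈ G let
-- T̂(γ) = Σₓ 1_T(x) (-1)^{γ·x} and w(γ) = Â(γ)² ≥ 0.  Since T avoids A + A,
-- Σ_γ T̂(γ) w(γ) = N Σₓ 1_T(x) (1_A * 1_A)(x) = 0, while Parseval gives
-- Σ_γ w(γ) = N a.  On V⊥ we have T̂ = t, and V⊥ carries weight Z ≥ w(0) = a².
-- Hence off V⊥ the w-weighted sum of deficit(γ) = T̂(γ)(N - a) + t a equals
-- t N (a² - Z) ≤ 0, so averaging yields γ ∉ V⊥ with deficit(γ) ≤ 0 (if T = ∅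
-- every deficit is 0).  For V' = V ∩ γ⊥ we have |V| = 2|V'| and
-- 2|V' ∖ (A+A)| = t + T̂(γ), and the claim is then pure algebra.

open import Defs
open import Data.Nat using (ℕ; zero; suc; _≥_; _>_; _^_; z≤n) renaming (_+_ to _+ℕ_)
import Data.Nat.Properties as ℕ
open import Data.Integer
  using (ℤ; +_; _-_; _*_; _+_; -_; _≤_; _<_; 0ℤ; 1ℤ; -1ℤ; +≤+; +<+; +[1+_]; -[1+_])
open import Data.Integer.Base using (positive; nonNegative)
open import Data.Integer.Properties
open import Data.Integer.Tactic.RingSolver using (solve-∀)
open import Algebra.Bundles using (CommutativeRing)
open import Data.Bool using (Bool; true; false; _xor_; _∧_; _∨_; not; if_then_else_)
open import Data.Bool.Properties
  using (xor-assoc; xor-comm; xor-identityˡ; xor-same; ∧-distribˡ-xor;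
         xor-∧-commutativeRing; ∧-assoc; ∧-comm; ∧-zeroʳ; ∨-zeroʳ)
  renaming (_≟_ to _≟B_)
open import Algebra.Properties.CommutativeSemigroup
  (CommutativeRing.+-commutativeSemigroup xor-∧-commutativeRing)
  using () renaming (interchange to xor-interchange)
open import Algebra.Properties.CommutativeSemigroup +-commutativeSemigroup
  using () renaming (interchange to +-interchange)
open import Data.Vec using (Vec; []; _∷_; replicate)
import Data.Vec as Vec
open import Data.Vec.Properties using (∷-injectiveʳ; ≡-dec)
open import Data.Vec.Relation.Binary.Pointwise.Inductive
  using (Pointwise-≡⇒≡; zipWith-assoc; zipWith-comm; zipWith-identityˡ)
open import Data.List using ([]; _∷_; map; _++_)
open import Data.List.Membership.Propositional using () renaming (_∈_ to _∈ₗ_)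
open import Data.List.Membership.Propositional.Properties using (∈-++⁺ˡ; ∈-++⁺ʳ; ∈-map⁺)
open import Data.List.Relation.Unary.Any using (here; there)
open import Data.Product using (Σ; _×_; _,_; proj₁; proj₂)
open import Data.Sum using (_⊎_; inj₁; inj₂)
open import Data.Empty using (⊥-elim)
open import Relation.Nullary using (yes; no; ¬_)
open import Relation.Nullary.Decidable using (toWitnessFalse)
open import Relation.Binary.PropositionalEquality

open ≡-Reasoning

∧-elim : ∀ {a b} → a ∧ b ≡ true → (a ≡ true) × (b ≡ true)
∧-elim {true} {true} _ = refl , refl

==-refl : ∀ {n} (x : G n) → (x == x) ≡ true
==-refl x with ≡-dec _≟B_ x x
... | yes _ = refl
... | no x≢x = ⊥-elim (x≢x refl)

⊕-assoc : ∀ {n} (x y z : G n) → (x ⊕ y) ⊕ z ≡ x ⊕ (y ⊕ z)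
⊕-assoc x y z = Pointwise-≡⇒≡ (zipWith-assoc xor-assoc x y z)

⊕-comm : ∀ {n} (x y : G n) → x ⊕ y ≡ y ⊕ x
⊕-comm x y = Pointwise-≡⇒≡ (zipWith-comm xor-comm x y)

⊕-identityˡ : ∀ {n} (x : G n) → 0G ⊕ x ≡ x
⊕-identityˡ x = Pointwise-≡⇒≡ (zipWith-identityˡ xor-identityˡ x)

⊕-identityʳ : ∀ {n} (x : G n) → x ⊕ 0G ≡ x
⊕-identityʳ x = trans (⊕-comm x 0G) (⊕-identityˡ x)

⊕-self : ∀ {n} (x : G n) → x ⊕ x ≡ 0G
⊕-self [] = refl
⊕-self (b ∷ x) = cong₂ _∷_ (xor-same b) (⊕-self x)

⊕-cancelˡ : ∀ {n} (x y : G n) → x ⊕ (x ⊕ y) ≡ y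
⊕-cancelˡ x y = begin
  x ⊕ (x ⊕ y)  ≡⟨ ⊕-assoc x x y ⟨
  (x ⊕ x) ⊕ y  ≡⟨ cong (_⊕ y) (⊕-self x) ⟩
  0G ⊕ y       ≡⟨ ⊕-identityˡ y ⟩
  y            ∎

⊕-cancelʳ : ∀ {n} (x y : G n) → (x ⊕ y) ⊕ y ≡ x
⊕-cancelʳ x y = begin
  (x ⊕ y) ⊕ y  ≡⟨ ⊕-assoc x y y ⟩
  x ⊕ (y ⊕ y)  ≡⟨ cong (x ⊕_) (⊕-self y) ⟩
  x ⊕ 0G       ≡⟨ ⊕-identityʳ x ⟩
  x            ∎

⊕≡0⇒≡ : ∀ {n} {x y : G n} → x ⊕ y ≡ 0G → x ≡ y
⊕≡0⇒≡ {x = x} {y} e = begin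
  x            ≡⟨ ⊕-identityʳ x ⟨
  x ⊕ 0G       ≡⟨ cong (x ⊕_) e ⟨
  x ⊕ (x ⊕ y)  ≡⟨ ⊕-cancelˡ x y ⟩
  y            ∎

_·_ : ∀ {n} → G n → G n → Bool
[] · [] = false
(c ∷ γ) · (b ∷ x) = (c ∧ b) xor (γ · x)

·-⊕ʳ : ∀ {n} (γ x y : G n) → γ · (x ⊕ y) ≡ (γ · x) xor (γ · y)
·-⊕ʳ [] [] [] = refl
·-⊕ʳ (c ∷ γ) (a ∷ x) (b ∷ y) = begin
  (c ∧ (a xor b)) xor (γ · (x ⊕ y))
    ≡⟨ cong₂ _xor_ (∧-distribˡ-xor c a b) (·-⊕ʳ γ x y) ⟩
  ((c ∧ a) xor (c ∧ b)) xor ((γ · x) xor (γ · y))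
    ≡⟨ xor-interchange (c ∧ a) (c ∧ b) (γ · x) (γ · y) ⟩
  ((c ∧ a) xor (γ · x)) xor ((c ∧ b) xor (γ · y)) ∎

·-0ˡ : ∀ {n} (x : G n) → 0G · x ≡ false
·-0ˡ [] = refl
·-0ˡ (b ∷ x) = ·-0ˡ x

·-0ʳ : ∀ {n} (γ : G n) → γ · 0G ≡ false
·-0ʳ [] = refl
·-0ʳ (c ∷ γ) = trans (cong (_xor (γ · 0G)) (∧-comm c false)) (·-0ʳ γ)

nonzero-detected : ∀ {n} {x : G n} → x ≢ 0G → Σ (G n) λ γ → γ · x ≡ true
nonzero-detected {x = []} x≢0 = ⊥-elim (x≢0 refl)
nonzero-detected {x = true ∷ x} _ = (true ∷ 0G) , cong not (·-0ˡ x)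
nonzero-detected {x = false ∷ x} x≢0 =
  let (γ , γx) = nonzero-detected (λ x≡0 → x≢0 (cong (false ∷_) x≡0)) in (false ∷ γ) , γx

allG-complete : ∀ {n} (x : G n) → x ∈ₗ allG n
allG-complete [] = here refl
allG-complete (false ∷ x) = ∈-++⁺ˡ (∈-map⁺ (false ∷_) (allG-complete x))
allG-complete {suc n} (true ∷ x) =
  ∈-++⁺ʳ (map (false ∷_) (allG n)) (∈-map⁺ (true ∷_) (allG-complete x))

anyL-complete : ∀ {n} (p : G n → Bool) {x} {l} → x ∈ₗ l → p x ≡ true → anyL p l ≡ true
anyL-complete p {l = _ ∷ l} (here refl) px = cong (_∨ anyL p l) px
anyL-complete p {l = y ∷ _} (there x∈l) px = trans (cong (p y ∨_) (anyL-complete p x∈l px)) (∨-zeroʳ (p y))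

anyL-sound : ∀ {n} (p : G n → Bool) l → anyL p l ≡ true → Σ (G n) λ x → p x ≡ true
anyL-sound p (x ∷ l) found with p x in px
... | true = x , px
... | false = anyL-sound p l found

anyL-none : ∀ {n} (p : G n → Bool) l → (∀ x → p x ≡ false) → anyL p l ≡ false
anyL-none p [] none = refl
anyL-none p (x ∷ l) none rewrite none x = anyL-none p l none

anyL-false : ∀ {n} (p : G n → Bool) → anyL p (allG n) ≡ false → ∀ x → p x ≡ false
anyL-false p none x with p x in px
... | false = refl
... | true with () ← trans (sym (anyL-complete p (allG-complete x) px)) none

HasDim-cong : ∀ {n d} {W W′ : SubsetG n} → W ⊆ W′ → W′ ⊆ W → HasDim W d → HasDim W′ d
HasDim-cong W⊆W′ W′⊆W (B , indep , spans , inside) =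
  B , indep , (λ x x∈W′ → spans x (W′⊆W x x∈W′)) , (λ c → W⊆W′ _ (inside c))

extend-basis : ∀ {n d} {W H : SubsetG n} {v : G n} → IsSubspace W → H ⊆ W →
  v ∈ W → ¬ (v ∈ H) → (∀ x → x ∈ W → x ∈ H ⊎ (v ⊕ x) ∈ H) →
  HasDim H d → HasDim W (suc d)
extend-basis {d = d} {W} {H} {v} (0∈W , closed) H⊆W v∈W v∉H split (B , indep , spans , inside) =
  v ∷ B , indep′ , spans′ , inside′
  where
  indep′ : ∀ c → lincomb c (v ∷ B) ≡ 0G → c ≡ replicate (suc d) false
  indep′ (true ∷ c) e = ⊥-elim (v∉H (subst (_∈ H) (sym (⊕≡0⇒≡ e)) (inside c)))
  indep′ (false ∷ c) e = cong (false ∷_) (indep c (trans (sym (⊕-identityˡ _)) e))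

  spans′ : ∀ x → x ∈ W → Σ (Vec Bool (suc d)) λ c → lincomb c (v ∷ B) ≡ x
  spans′ x x∈W with split x x∈W
  ... | inj₁ x∈H = let (c , e) = spans x x∈H in false ∷ c , trans (⊕-identityˡ _) e
  ... | inj₂ v+x∈H = let (c , e) = spans (v ⊕ x) v+x∈H in
                     true ∷ c , trans (cong (v ⊕_) e) (⊕-cancelˡ v x)

  inside′ : ∀ c → lincomb c (v ∷ B) ∈ W
  inside′ (true ∷ c) = closed v _ v∈W (H⊆W _ (inside c))
  inside′ (false ∷ c) = closed 0G _ 0∈W (H⊆W _ (inside c))

lowerHalf : ∀ {n} → SubsetG (suc n) → SubsetG (suc n)
lowerHalf W (false ∷ x) = W (false ∷ x)
lowerHalf W (true ∷ x) = false

lowerHalf-⊆ : ∀ {n} (W : SubsetG (suc n)) → lowerHalf W ⊆ W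
lowerHalf-⊆ W (false ∷ x) x∈ = x∈

lincomb-lift : ∀ {n d} (c : Vec Bool d) (B : Vec (G n) d) →
  lincomb c (Vec.map (false ∷_) B) ≡ false ∷ lincomb c B
lincomb-lift [] [] = refl
lincomb-lift (true ∷ c) (b ∷ B) = cong ((false ∷ b) ⊕_) (lincomb-lift c B)
lincomb-lift (false ∷ c) (b ∷ B) = cong (0G ⊕_) (lincomb-lift c B)

lift-basis : ∀ {n d} (W : SubsetG (suc n)) → HasDim (λ x → W (false ∷ x)) d → HasDim (lowerHalf W) d
lift-basis {d = d} W (B , indep , spans , inside) = Vec.map (false ∷_) B , indep′ , spans′ , inside′
  where
  indep′ : ∀ c → lincomb c (Vec.map (false ∷_) B) ≡ 0G → c ≡ replicate d false
  indep′ c e = indep c (∷-injectiveʳ (trans (sym (lincomb-lift c B)) e))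

  spans′ : ∀ x → x ∈ lowerHalf W → Σ (Vec Bool d) λ c → lincomb c (Vec.map (false ∷_) B) ≡ x
  spans′ (false ∷ x) x∈ = let (c , e) = spans x x∈ in c , trans (lincomb-lift c B) (cong (false ∷_) e)

  inside′ : ∀ c → lincomb c (Vec.map (false ∷_) B) ∈ lowerHalf W
  inside′ c rewrite lincomb-lift c B = inside c

-- Every subspace of F₂ⁿ has a basis: split off the first coordinate and, if W
-- meets x₀ = 1 in some v, extend a basis of the lower half by v.
basis : ∀ {n} (W : SubsetG n) → IsSubspace W → Σ ℕ (HasDim W)
basis {zero} W (0∈W , _) =
  0 , [] , (λ { [] _ → refl }) , (λ { [] _ → [] , refl }) , (λ { [] → 0∈W })
basis {suc n} W (0∈W , closed)
  with basis (λ x → W (false ∷ x)) (0∈W , λ x y → closed (false ∷ x) (false ∷ y))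
     | anyL (λ u → W (true ∷ u)) (allG n) in upper
... | d , B₀ | true =
  let (u , u∈W) = anyL-sound _ (allG n) upper in
  suc d , extend-basis (0∈W , closed) (lowerHalf-⊆ W) u∈W (λ ()) (split u u∈W) (lift-basis W B₀)
  where
  split : ∀ u → (true ∷ u) ∈ W → ∀ x → x ∈ W → x ∈ lowerHalf W ⊎ ((true ∷ u) ⊕ x) ∈ lowerHalf W
  split u u∈W (false ∷ x) x∈W = inj₁ x∈W
  split u u∈W (true ∷ x) x∈W = inj₂ (closed (true ∷ u) (true ∷ x) u∈W x∈W)
... | d , B₀ | false = d , HasDim-cong (lowerHalf-⊆ W) W⊆lowerHalf (lift-basis W B₀)
  where
  W⊆lowerHalf : W ⊆ lowerHalf W
  W⊆lowerHalf (false ∷ x) x∈W = x∈W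
  W⊆lowerHalf (true ∷ x) x∈W
    with () ← trans (sym (anyL-complete _ (allG-complete x) x∈W)) upper

hyperplane : ∀ {n} → SubsetG n → G n → SubsetG n
hyperplane X γ x = X x ∧ not (γ · x)

hyperplane-intro : ∀ {n} (X : SubsetG n) γ x → x ∈ X → γ · x ≡ false → x ∈ hyperplane X γ
hyperplane-intro X γ x x∈X γx rewrite x∈X | γx = refl

hyperplane-elim : ∀ {n} (X : SubsetG n) γ x → x ∈ hyperplane X γ → x ∈ X × γ · x ≡ false
hyperplane-elim X γ x x∈ with X x | γ · x
... | true | false = refl , refl

hyperplane-subspace : ∀ {n} {V : SubsetG n} γ → IsSubspace V → IsSubspace (hyperplane V γ)
hyperplane-subspace {V = V} γ (0∈V , closed) = hyperplane-intro V γ 0G 0∈V (·-0ʳ γ) , closed′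
  where
  closed′ : ∀ x y → x ∈ hyperplane V γ → y ∈ hyperplane V γ → (x ⊕ y) ∈ hyperplane V γ
  closed′ x y x∈ y∈ =
    let (x∈V , γx) = hyperplane-elim V γ x x∈ ; (y∈V , γy) = hyperplane-elim V γ y y∈ in
    hyperplane-intro V γ (x ⊕ y) (closed x y x∈V y∈V) (trans (·-⊕ʳ γ x y) (cong₂ _xor_ γx γy))

-- If γ·v = 1 for some v ∈ V, then V ∩ γ⊥ has co-dimension one in V:
-- every x ∈ V lies in V ∩ γ⊥ or in v + (V ∩ γ⊥).
hyperplane-codim : ∀ {n} {V : SubsetG n} {γ v} → IsSubspace V → v ∈ V → γ · v ≡ true →
  CodimOneIn (hyperplane V γ) V
hyperplane-codim {V = V} {γ} {v} V-sub v∈V γv with basis (hyperplane V γ) (hyperplane-subspace γ V-sub)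
... | d , H-basis =
  hyperplane-subspace γ V-sub , H⊆V , d , extend-basis V-sub H⊆V v∈V v∉H split H-basis , H-basis
  where
  H⊆V : hyperplane V γ ⊆ V
  H⊆V x x∈ = proj₁ (hyperplane-elim V γ x x∈)

  v∉H : ¬ (v ∈ hyperplane V γ)
  v∉H v∈ with () ← trans (sym γv) (proj₂ (hyperplane-elim V γ v v∈))

  split : ∀ x → x ∈ V → x ∈ hyperplane V γ ⊎ (v ⊕ x) ∈ hyperplane V γ
  split x x∈V = by-value (γ · x) refl
    where
    by-value : ∀ b → γ · x ≡ b → x ∈ hyperplane V γ ⊎ (v ⊕ x) ∈ hyperplane V γ
    by-value false γx = inj₁ (hyperplane-intro V γ x x∈V γx)
    by-value true γx = inj₂ (hyperplane-intro V γ (v ⊕ x) (proj₂ V-sub v x v∈V x∈V)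
                               (trans (·-⊕ʳ γ v x) (cong₂ _xor_ γv γx)))

∑ : ∀ {n} → (G n → ℤ) → ℤ
∑ {zero} f = f []
∑ {suc n} f = ∑ (λ x → f (false ∷ x)) + ∑ (λ x → f (true ∷ x))

∑-cong : ∀ {n} {f g : G n → ℤ} → (∀ x → f x ≡ g x) → ∑ f ≡ ∑ g
∑-cong {zero} f≡g = f≡g []
∑-cong {suc n} f≡g = cong₂ _+_ (∑-cong {n} (λ x → f≡g (false ∷ x))) (∑-cong {n} (λ x → f≡g (true ∷ x)))

∑-zero : ∀ {n} → ∑ {n} (λ _ → 0ℤ) ≡ 0ℤ
∑-zero {zero} = refl
∑-zero {suc n} = cong₂ _+_ (∑-zero {n}) (∑-zero {n})

∑-+ : ∀ {n} (f g : G n → ℤ) → ∑ (λ x → f x + g x) ≡ ∑ f + ∑ g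
∑-+ {zero} f g = refl
∑-+ {suc n} f g = begin
  ∑ (λ x → f (false ∷ x) + g (false ∷ x)) + ∑ (λ x → f (true ∷ x) + g (true ∷ x))
    ≡⟨ cong₂ _+_ (∑-+ {n} _ _) (∑-+ {n} _ _) ⟩
  (∑ (λ x → f (false ∷ x)) + ∑ (λ x → g (false ∷ x))) + (∑ (λ x → f (true ∷ x)) + ∑ (λ x → g (true ∷ x)))
    ≡⟨ +-interchange (∑ (λ x → f (false ∷ x))) (∑ (λ x → g (false ∷ x)))
                    (∑ (λ x → f (true ∷ x))) (∑ (λ x → g (true ∷ x))) ⟩
  ∑ f + ∑ g ∎

∑-*ˡ : ∀ {n} (c : ℤ) (f : G n → ℤ) → ∑ (λ x → c * f x) ≡ c * ∑ f
∑-*ˡ {zero} c f = refl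
∑-*ˡ {suc n} c f = trans (cong₂ _+_ (∑-*ˡ {n} c _) (∑-*ˡ {n} c _))
  (sym (*-distribˡ-+ c (∑ (λ x → f (false ∷ x))) (∑ (λ x → f (true ∷ x)))))

∑-neg : ∀ {n} (f : G n → ℤ) → ∑ (λ x → - f x) ≡ - ∑ f
∑-neg {zero} f = refl
∑-neg {suc n} f = trans (cong₂ _+_ (∑-neg {n} _) (∑-neg {n} _))
  (sym (neg-distrib-+ (∑ (λ x → f (false ∷ x))) (∑ (λ x → f (true ∷ x)))))

∑-mono : ∀ {n} {f g : G n → ℤ} → (∀ x → f x ≤ g x) → ∑ f ≤ ∑ g
∑-mono {zero} f≤g = f≤g []
∑-mono {suc n} f≤g = +-mono-≤ (∑-mono {n} (λ x → f≤g (false ∷ x))) (∑-mono {n} (λ x → f≤g (true ∷ x)))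

∑-nonneg : ∀ {n} {f : G n → ℤ} → (∀ x → 0ℤ ≤ f x) → 0ℤ ≤ ∑ f
∑-nonneg {n} {f} f≥0 = subst (_≤ ∑ f) (∑-zero {n}) (∑-mono f≥0)

∑-term : ∀ {n} {f : G n → ℤ} → (∀ x → 0ℤ ≤ f x) → ∀ x → f x ≤ ∑ f
∑-term f≥0 [] = ≤-refl
∑-term {f = f} f≥0 (false ∷ x) =
  ≤-trans (∑-term {f = λ y → f (false ∷ y)} (λ y → f≥0 (false ∷ y)) x)
          (i≤i+j _ _ {{nonNegative (∑-nonneg {f = λ y → f (true ∷ y)} (λ y → f≥0 (true ∷ y)))}})
∑-term {f = f} f≥0 (true ∷ x) =
  ≤-trans (∑-term {f = λ y → f (true ∷ y)} (λ y → f≥0 (true ∷ y)) x)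
          (i≤j+i _ _ {{nonNegative (∑-nonneg {f = λ y → f (false ∷ y)} (λ y → f≥0 (false ∷ y)))}})

∑-swap : ∀ {n m} (f : G n → G m → ℤ) → ∑ (λ x → ∑ (f x)) ≡ ∑ (λ y → ∑ (λ x → f x y))
∑-swap {zero} f = refl
∑-swap {suc n} {m} f = begin
  ∑ (λ x → ∑ (f (false ∷ x))) + ∑ (λ x → ∑ (f (true ∷ x)))
    ≡⟨ cong₂ _+_ (∑-swap {n} {m} _) (∑-swap {n} {m} _) ⟩
  ∑ (λ y → ∑ (λ x → f (false ∷ x) y)) + ∑ (λ y → ∑ (λ x → f (true ∷ x) y))
    ≡⟨ ∑-+ (λ y → ∑ (λ x → f (false ∷ x) y)) (λ y → ∑ (λ x → f (true ∷ x) y)) ⟨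
  ∑ (λ y → ∑ (λ x → f x y)) ∎

∑-translate : ∀ {n} (f : G n → ℤ) (z : G n) → ∑ (λ x → f (x ⊕ z)) ≡ ∑ f
∑-translate f [] = refl
∑-translate f (false ∷ z) =
  cong₂ _+_ (∑-translate (λ x → f (false ∷ x)) z) (∑-translate (λ x → f (true ∷ x)) z)
∑-translate f (true ∷ z) =
  trans (cong₂ _+_ (∑-translate (λ x → f (true ∷ x)) z) (∑-translate (λ x → f (false ∷ x)) z))
        (+-comm (∑ (λ x → f (true ∷ x))) (∑ (λ x → f (false ∷ x))))

restrict : ∀ {n} → (G n → Bool) → (G n → ℤ) → G n → ℤ
restrict p f x = if p x then f x else 0ℤ

∑-split : ∀ {n} (p : G n → Bool) (f : G n → ℤ) →
  ∑ f ≡ ∑ (restrict p f) + ∑ (restrict (λ x → not (p x)) f)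
∑-split p f = trans (∑-cong pointwise) (∑-+ (restrict p f) (restrict (λ x → not (p x)) f))
  where
  pointwise : ∀ x → f x ≡ restrict p f x + restrict (λ x → not (p x)) f x
  pointwise x with p x
  ... | true = sym (+-identityʳ (f x))
  ... | false = sym (+-identityˡ (f x))

restrict-nonneg : ∀ {n} (p : G n → Bool) {f : G n → ℤ} → (∀ x → 0ℤ ≤ f x) → ∀ x → 0ℤ ≤ restrict p f x
restrict-nonneg p f≥0 x with p x
... | true = f≥0 x
... | false = ≤-refl

restrict-support : ∀ {n} (p : G n → Bool) {f : G n → ℤ} {x} → 0ℤ < restrict p f x → p x ≡ true
restrict-support p {x = x} pos with p x
... | true = refl
... | false = ⊥-elim (<-irrefl refl pos)

+-<-split : ∀ {a b c d : ℤ} → a + b < c + d → a < c ⊎ b < d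
+-<-split {a} {b} {c} {d} lt with a <? c | b <? d
... | yes a<c | _ = inj₁ a<c
... | no _ | yes b<d = inj₂ b<d
... | no a≮c | no b≮d = ⊥-elim (<⇒≱ lt (+-mono-≤ (≮⇒≥ a≮c) (≮⇒≥ b≮d)))

-- Averaging for non-negative weights w: if Σ w h < Σ w, then h ≤ 0 at some
-- point of positive weight (otherwise w h ≥ w everywhere).
∑-averaging : ∀ {n} (w h : G n → ℤ) → (∀ x → 0ℤ ≤ w x) →
  ∑ (λ x → w x * h x) < ∑ w → Σ (G n) λ x → (0ℤ < w x) × (h x ≤ 0ℤ)
∑-averaging {zero} w h w≥0 lt = [] , single (w≥0 []) lt
  where
  single : ∀ {u k} → 0ℤ ≤ u → u * k < u → (0ℤ < u) × (k ≤ 0ℤ)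
  single {u} {k} u≥0 uk<u with 0ℤ <? u | k ≤? 0ℤ
  ... | yes u>0 | yes k≤0 = u>0 , k≤0
  ... | _ | no k≰0 = ⊥-elim (<⇒≱ uk<u
          (subst (_≤ u * k) (*-identityʳ u) (*-monoˡ-≤-nonNeg u {{nonNegative u≥0}} (i<j⇒suc[i]≤j (≰⇒> k≰0)))))
  ... | no u≯0 | yes _ with refl ← ≤-antisym (≮⇒≥ u≯0) u≥0 = ⊥-elim (<-irrefl (*-zeroˡ k) uk<u)
∑-averaging {suc n} w h w≥0 lt with +-<-split lt
... | inj₁ lower =
  let (x , p) = ∑-averaging (λ x → w (false ∷ x)) (λ x → h (false ∷ x)) (λ x → w≥0 (false ∷ x)) lower
  in false ∷ x , p
... | inj₂ upper =
  let (x , p) = ∑-averaging (λ x → w (true ∷ x)) (λ x → h (true ∷ x)) (λ x → w≥0 (true ∷ x)) upper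
  in true ∷ x , p

self-negating : ∀ {i : ℤ} → - i ≡ i → i ≡ 0ℤ
self-negating {+ zero} _ = refl
self-negating {+[1+ m ]} ()
self-negating { -[1+ m ]} ()

neg≤self : ∀ {i : ℤ} → 0ℤ ≤ i → - i ≤ i
neg≤self i≥0 = ≤-trans (neg-mono-≤ i≥0) i≥0

square-nonneg : ∀ i → 0ℤ ≤ i * i
square-nonneg (+ zero) = +≤+ z≤n
square-nonneg +[1+ m ] = +≤+ z≤n
square-nonneg -[1+ m ] = +≤+ z≤n

move-right : ∀ {x y z : ℤ} → y ≡ x + z → x ≡ y - z
move-right {x} {z = z} refl = sym (cancel x z)
  where
  cancel : ∀ x z → x + z - z ≡ x
  cancel = solve-∀

*-nonneg : ∀ {i j : ℤ} → 0ℤ ≤ i → 0ℤ ≤ j → 0ℤ ≤ i * j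
*-nonneg {i} i≥0 j≥0 = subst (_≤ i * _) (*-zeroʳ i) (*-monoˡ-≤-nonNeg i {{nonNegative i≥0}} j≥0)

∣G∣ : ℕ → ℤ
∣G∣ n = + (2 ^ n)

∣G∣-suc : ∀ n → ∣G∣ (suc n) ≡ ∣G∣ n + ∣G∣ n
∣G∣-suc n = trans (cong (λ k → + (2 ^ n +ℕ k)) (ℕ.+-identityʳ (2 ^ n))) (pos-+ (2 ^ n) (2 ^ n))

χ : ∀ {n} → G n → G n → ℤ
χ γ x = if γ · x then -1ℤ else 1ℤ

χ-⊕ : ∀ {n} (γ x y : G n) → χ γ (x ⊕ y) ≡ χ γ x * χ γ y
χ-⊕ γ x y rewrite ·-⊕ʳ γ x y with γ · x | γ · y
... | true | true = refl
... | true | false = refl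
... | false | true = refl
... | false | false = refl

δ : ∀ {n} → G n → ℤ
δ [] = 1ℤ
δ (b ∷ y) = if b then 0ℤ else δ y

∑-δ : ∀ {n} (f : G n → ℤ) → ∑ (λ y → f y * δ y) ≡ f 0G
∑-δ {zero} f = *-identityʳ (f [])
∑-δ {suc n} f = begin
  ∑ (λ y → f (false ∷ y) * δ y) + ∑ (λ y → f (true ∷ y) * 0ℤ)
    ≡⟨ cong₂ _+_ (∑-δ (λ y → f (false ∷ y)))
                 (trans (∑-cong (λ y → *-zeroʳ (f (true ∷ y)))) (∑-zero {n})) ⟩
  f 0G + 0ℤ  ≡⟨ +-identityʳ (f 0G) ⟩
  f 0G       ∎

orthogonality : ∀ {n} (y : G n) → ∑ (λ γ → χ γ y) ≡ ∣G∣ n * δ y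
orthogonality [] = refl
orthogonality {suc n} (false ∷ y) = begin
  ∑ (λ γ → χ γ y) + ∑ (λ γ → χ γ y)  ≡⟨ cong₂ _+_ (orthogonality y) (orthogonality y) ⟩
  ∣G∣ n * δ y + ∣G∣ n * δ y          ≡⟨ *-distribʳ-+ (δ y) (∣G∣ n) (∣G∣ n) ⟨
  (∣G∣ n + ∣G∣ n) * δ y              ≡⟨ cong (_* δ y) (∣G∣-suc n) ⟨
  ∣G∣ (suc n) * δ y                  ∎
orthogonality {suc n} (true ∷ y) = begin
  ∑ (λ γ → χ γ y) + ∑ (λ γ → χ (true ∷ γ) (true ∷ y))
    ≡⟨ cong (λ s → ∑ (λ γ → χ γ y) + s) (trans (∑-cong flipped) (∑-neg (λ γ → χ γ y))) ⟩
  ∑ (λ γ → χ γ y) + - ∑ (λ γ → χ γ y)  ≡⟨ +-inverseʳ (∑ (λ γ → χ γ y)) ⟩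
  0ℤ                                   ≡⟨ *-zeroʳ (∣G∣ (suc n)) ⟨
  ∣G∣ (suc n) * 0ℤ                     ∎
  where
  flipped : ∀ γ → χ (true ∷ γ) (true ∷ y) ≡ - χ γ y
  flipped γ with γ · y
  ... | true = refl
  ... | false = refl

hat : ∀ {n} → (G n → ℤ) → G n → ℤ
hat f γ = ∑ (λ x → f x * χ γ x)

hat-cong : ∀ {n} {f g : G n → ℤ} → (∀ x → f x ≡ g x) → ∀ γ → hat f γ ≡ hat g γ
hat-cong f≡g γ = ∑-cong (λ x → cong (_* χ γ x) (f≡g x))

hat-0 : ∀ {n} (f : G n → ℤ) → hat f 0G ≡ ∑ f
hat-0 f = ∑-cong (λ x → trans (cong (λ b → f x * (if b then -1ℤ else 1ℤ)) (·-0ˡ x)) (*-identityʳ (f x)))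

hat-translate : ∀ {n} (f : G n → ℤ) (γ z : G n) → χ γ z * hat f γ ≡ hat (λ x → f (x ⊕ z)) γ
hat-translate f γ z = begin
  χ γ z * hat f γ                           ≡⟨ ∑-*ˡ (χ γ z) (λ x → f x * χ γ x) ⟨
  ∑ (λ x → χ γ z * (f x * χ γ x))           ≡⟨ ∑-cong substitute ⟩
  ∑ (λ x → f ((x ⊕ z) ⊕ z) * χ γ (x ⊕ z))   ≡⟨ ∑-translate (λ x → f (x ⊕ z) * χ γ x) z ⟩
  hat (λ x → f (x ⊕ z)) γ                   ∎
  where
  rearrange : ∀ c p q → c * (p * q) ≡ p * (q * c)
  rearrange = solve-∀

  substitute : ∀ x → χ γ z * (f x * χ γ x) ≡ f ((x ⊕ z) ⊕ z) * χ γ (x ⊕ z)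
  substitute x = begin
    χ γ z * (f x * χ γ x)          ≡⟨ rearrange (χ γ z) (f x) (χ γ x) ⟩
    f x * (χ γ x * χ γ z)          ≡⟨ cong₂ _*_ (cong f (⊕-cancelʳ x z)) (χ-⊕ γ x z) ⟨
    f ((x ⊕ z) ⊕ z) * χ γ (x ⊕ z)  ∎

hat-sum : ∀ {n} (f : G n → ℤ) → ∑ (hat f) ≡ ∣G∣ n * f 0G
hat-sum {n} f = begin
  ∑ (λ γ → ∑ (λ x → f x * χ γ x))  ≡⟨ ∑-swap (λ γ x → f x * χ γ x) ⟩
  ∑ (λ x → ∑ (λ γ → f x * χ γ x))
    ≡⟨ ∑-cong (λ x → trans (∑-*ˡ (f x) (λ γ → χ γ x)) (cong (f x *_) (orthogonality x))) ⟩
  ∑ (λ x → f x * (∣G∣ n * δ x))    ≡⟨ ∑-cong (λ x → rearrange (f x) (∣G∣ n) (δ x)) ⟩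
  ∑ (λ x → ∣G∣ n * (f x * δ x))    ≡⟨ ∑-*ˡ (∣G∣ n) (λ x → f x * δ x) ⟩
  ∣G∣ n * ∑ (λ x → f x * δ x)      ≡⟨ cong (∣G∣ n *_) (∑-δ f) ⟩
  ∣G∣ n * f 0G                     ∎
  where
  rearrange : ∀ p c q → p * (c * q) ≡ c * (p * q)
  rearrange = solve-∀

hat-pairing : ∀ {n} (f F : G n → ℤ) →
  ∑ (λ γ → hat f γ * F γ) ≡ ∑ (λ x → f x * ∑ (λ γ → χ γ x * F γ))
hat-pairing f F = begin
  ∑ (λ γ → hat f γ * F γ)
    ≡⟨ ∑-cong (λ γ → trans (*-comm (hat f γ) (F γ)) (sym (∑-*ˡ (F γ) (λ x → f x * χ γ x)))) ⟩
  ∑ (λ γ → ∑ (λ x → F γ * (f x * χ γ x)))  ≡⟨ ∑-swap (λ γ x → F γ * (f x * χ γ x)) ⟩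
  ∑ (λ x → ∑ (λ γ → F γ * (f x * χ γ x)))
    ≡⟨ ∑-cong (λ x → trans (∑-cong (λ γ → rearrange (F γ) (f x) (χ γ x))) (∑-*ˡ (f x) (λ γ → χ γ x * F γ))) ⟩
  ∑ (λ x → f x * ∑ (λ γ → χ γ x * F γ))    ∎
  where
  rearrange : ∀ c p q → c * (p * q) ≡ p * (q * c)
  rearrange = solve-∀

parseval : ∀ {n} (f g : G n → ℤ) → ∑ (λ γ → hat f γ * hat g γ) ≡ ∣G∣ n * ∑ (λ x → f x * g x)
parseval {n} f g = begin
  ∑ (λ γ → hat f γ * hat g γ)                 ≡⟨ hat-pairing f (hat g) ⟩
  ∑ (λ x → f x * ∑ (λ γ → χ γ x * hat g γ))   ≡⟨ ∑-cong (λ x → cong (f x *_) (inversion x)) ⟩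
  ∑ (λ x → f x * (∣G∣ n * g x))               ≡⟨ ∑-cong (λ x → rearrange (f x) (∣G∣ n) (g x)) ⟩
  ∑ (λ x → ∣G∣ n * (f x * g x))               ≡⟨ ∑-*ˡ (∣G∣ n) (λ x → f x * g x) ⟩
  ∣G∣ n * ∑ (λ x → f x * g x)                 ∎
  where
  rearrange : ∀ p c q → p * (c * q) ≡ c * (p * q)
  rearrange = solve-∀

  inversion : ∀ x → ∑ (λ γ → χ γ x * hat g γ) ≡ ∣G∣ n * g x
  inversion x = begin
    ∑ (λ γ → χ γ x * hat g γ)    ≡⟨ ∑-cong (λ γ → hat-translate g γ x) ⟩
    ∑ (hat (λ y → g (y ⊕ x)))    ≡⟨ hat-sum (λ y → g (y ⊕ x)) ⟩
    ∣G∣ n * g (0G ⊕ x)           ≡⟨ cong (λ y → ∣G∣ n * g y) (⊕-identityˡ x) ⟩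
    ∣G∣ n * g x                  ∎

-- The Fourier side of correlating t with the convolution f * f:
-- Σ_γ t̂(γ) f̂(γ)² = |G| Σₓ t(x) Σ_b f(b ⊕ x) f(b).
convolution-identity : ∀ {n} (t f : G n → ℤ) →
  ∑ (λ γ → hat t γ * (hat f γ * hat f γ)) ≡ ∑ (λ x → t x * (∣G∣ n * ∑ (λ b → f (b ⊕ x) * f b)))
convolution-identity {n} t f =
  trans (hat-pairing t (λ γ → hat f γ * hat f γ)) (∑-cong (λ x → cong (t x *_) (shifted-parseval x)))
  where
  shifted-parseval : ∀ x → ∑ (λ γ → χ γ x * (hat f γ * hat f γ)) ≡ ∣G∣ n * ∑ (λ b → f (b ⊕ x) * f b)
  shifted-parseval x = begin
    ∑ (λ γ → χ γ x * (hat f γ * hat f γ))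
      ≡⟨ ∑-cong (λ γ → trans (sym (*-assoc (χ γ x) (hat f γ) (hat f γ)))
                             (cong (_* hat f γ) (hat-translate f γ x))) ⟩
    ∑ (λ γ → hat (λ b → f (b ⊕ x)) γ * hat f γ)  ≡⟨ parseval (λ b → f (b ⊕ x)) f ⟩
    ∣G∣ n * ∑ (λ b → f (b ⊕ x) * f b)            ∎

hat-bounds : ∀ {n} {f : G n → ℤ} → (∀ x → 0ℤ ≤ f x) → ∀ γ → (- ∑ f ≤ hat f γ) × (hat f γ ≤ ∑ f)
hat-bounds {f = f} f≥0 γ =
  subst (_≤ hat f γ) (∑-neg f) (∑-mono (λ x → proj₁ (sign-bounds (f≥0 x) (γ · x)))) ,
  ∑-mono (λ x → proj₂ (sign-bounds (f≥0 x) (γ · x)))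
  where
  sign-bounds : ∀ {i} → 0ℤ ≤ i → ∀ d →
    (- i ≤ i * (if d then -1ℤ else 1ℤ)) × (i * (if d then -1ℤ else 1ℤ) ≤ i)
  sign-bounds {i} i≥0 true rewrite *-comm i -1ℤ | -1*i≡-i i = ≤-refl , neg≤self i≥0
  sign-bounds {i} i≥0 false rewrite *-identityʳ i = neg≤self i≥0 , ≤-refl

ι : Bool → ℤ
ι b = if b then 1ℤ else 0ℤ

𝟙 : ∀ {n} → SubsetG n → G n → ℤ
𝟙 X x = ι (X x)

𝟙-nonneg : ∀ {n} (X : SubsetG n) x → 0ℤ ≤ 𝟙 X x
𝟙-nonneg X x with X x
... | true = +≤+ z≤n
... | false = +≤+ z≤n

ι-idem : ∀ b → ι b * ι b ≡ ι b
ι-idem true = refl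
ι-idem false = refl

countL-++ : ∀ {n} (p : G n → Bool) l₁ l₂ → countL p (l₁ ++ l₂) ≡ countL p l₁ +ℕ countL p l₂
countL-++ p [] l₂ = refl
countL-++ p (x ∷ l₁) l₂ =
  trans (cong ((if p x then 1 else 0) +ℕ_) (countL-++ p l₁ l₂)) (sym (ℕ.+-assoc (if p x then 1 else 0) (countL p l₁) (countL p l₂)))

countL-map : ∀ {m n} (p : G n → Bool) (f : G m → G n) l → countL p (map f l) ≡ countL (λ x → p (f x)) l
countL-map p f [] = refl
countL-map p f (x ∷ l) = cong ((if p (f x) then 1 else 0) +ℕ_) (countL-map p f l)

card-∑ : ∀ {n} (X : SubsetG n) → + card X ≡ ∑ (𝟙 X)
card-∑ {zero} X with X []
... | true = refl
... | false = refl
card-∑ {suc n} X = begin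
  + countL X (map (false ∷_) (allG n) ++ map (true ∷_) (allG n))
    ≡⟨ cong +_ (countL-++ X (map (false ∷_) (allG n)) (map (true ∷_) (allG n))) ⟩
  + (countL X (map (false ∷_) (allG n)) +ℕ countL X (map (true ∷_) (allG n)))
    ≡⟨ cong +_ (cong₂ _+ℕ_ (countL-map X (false ∷_) (allG n)) (countL-map X (true ∷_) (allG n))) ⟩
  + (card (λ x → X (false ∷ x)) +ℕ card (λ x → X (true ∷ x)))
    ≡⟨ pos-+ (card (λ x → X (false ∷ x))) (card (λ x → X (true ∷ x))) ⟩
  + card (λ x → X (false ∷ x)) + + card (λ x → X (true ∷ x))
    ≡⟨ cong₂ _+_ (card-∑ (λ x → X (false ∷ x))) (card-∑ (λ x → X (true ∷ x))) ⟩
  ∑ (𝟙 X) ∎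

card-cong : ∀ {n} {X Y : SubsetG n} → (∀ x → X x ≡ Y x) → + card X ≡ + card Y
card-cong {X = X} {Y} X≡Y = trans (card-∑ X) (trans (∑-cong (λ x → cong ι (X≡Y x))) (sym (card-∑ Y)))

hyperplane-count : ∀ {n} (X : SubsetG n) (γ : G n) →
  + card (hyperplane X γ) + + card (hyperplane X γ) ≡ + card X + hat (𝟙 X) γ
hyperplane-count X γ = begin
  + card H + + card H               ≡⟨ cong₂ _+_ (card-∑ H) (card-∑ H) ⟩
  ∑ (𝟙 H) + ∑ (𝟙 H)                 ≡⟨ ∑-+ (𝟙 H) (𝟙 H) ⟨
  ∑ (λ x → 𝟙 H x + 𝟙 H x)           ≡⟨ ∑-cong (λ x → pointwise (X x) (γ · x)) ⟩
  ∑ (λ x → 𝟙 X x + 𝟙 X x * χ γ x)   ≡⟨ ∑-+ (𝟙 X) (λ x → 𝟙 X x * χ γ x) ⟩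
  ∑ (𝟙 X) + hat (𝟙 X) γ             ≡⟨ cong (_+ hat (𝟙 X) γ) (card-∑ X) ⟨
  + card X + hat (𝟙 X) γ            ∎
  where
  H : SubsetG _
  H = hyperplane X γ

  pointwise : ∀ b d → ι (b ∧ not d) + ι (b ∧ not d) ≡ ι b + ι b * (if d then -1ℤ else 1ℤ)
  pointwise true true = refl
  pointwise true false = refl
  pointwise false d = refl

subspace-shift : ∀ {n} {V : SubsetG n} {v} → IsSubspace V → v ∈ V → ∀ x → V (x ⊕ v) ≡ V x
subspace-shift {V = V} {v} (_ , closed) v∈V x with V x in x∈V
... | true = closed x v x∈V v∈V
... | false with V (x ⊕ v) in x+v∈V
...   | false = refl
...   | true with () ← trans (sym (subst (_∈ V) (⊕-cancelʳ x v) (closed (x ⊕ v) v x+v∈V v∈V))) x∈V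

-- If γ·v = 1 for some v ∈ V, then 1̂_V(γ) = 0: translating by v flips its sign.
subspace-hat-vanishes : ∀ {n} {V : SubsetG n} (γ : G n) {v} → IsSubspace V → v ∈ V → γ · v ≡ true →
  hat (𝟙 V) γ ≡ 0ℤ
subspace-hat-vanishes {V = V} γ {v} V-sub v∈V γv = self-negating (begin
  - hat (𝟙 V) γ               ≡⟨ -1*i≡-i (hat (𝟙 V) γ) ⟨
  -1ℤ * hat (𝟙 V) γ           ≡⟨ cong (λ b → (if b then -1ℤ else 1ℤ) * hat (𝟙 V) γ) γv ⟨
  χ γ v * hat (𝟙 V) γ         ≡⟨ hat-translate (𝟙 V) γ v ⟩
  hat (λ x → 𝟙 V (x ⊕ v)) γ   ≡⟨ hat-cong (λ x → cong ι (subspace-shift V-sub v∈V x)) γ ⟩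
  hat (𝟙 V) γ                 ∎)

hyperplane-halves : ∀ {n} {V : SubsetG n} (γ : G n) {v} → IsSubspace V → v ∈ V → γ · v ≡ true →
  + card V ≡ + card (hyperplane V γ) + + card (hyperplane V γ)
hyperplane-halves {V = V} γ V-sub v∈V γv = sym (begin
  + card (hyperplane V γ) + + card (hyperplane V γ)  ≡⟨ hyperplane-count V γ ⟩
  + card V + hat (𝟙 V) γ  ≡⟨ cong (λ s → + card V + s) (subspace-hat-vanishes γ V-sub v∈V γv) ⟩
  + card V + 0ℤ           ≡⟨ +-identityʳ (+ card V) ⟩
  + card V                ∎)

sumset-complete : ∀ {n} (A : SubsetG n) {a a′} → a ∈ A → a′ ∈ A → (a ⊕ a′) ∈ sumset A
sumset-complete A {a} {a′} a∈A a′∈A =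
  anyL-complete _ (allG-complete a) (anyL-complete _ (allG-complete a′) pair)
  where
  pair : A a ∧ A a′ ∧ ((a ⊕ a′) == (a ⊕ a′)) ≡ true
  pair rewrite a∈A | a′∈A = ==-refl (a ⊕ a′)

no-representation : ∀ {n} (A : SubsetG n) {x} → sumset A x ≡ false → ∀ b → 𝟙 A (b ⊕ x) * 𝟙 A b ≡ 0ℤ
no-representation A {x} x∉A+A b with A (b ⊕ x) in b+x∈A | A b in b∈A
... | true | true
  with () ← trans (sym (subst (_∈ sumset A) (⊕-cancelˡ b x) (sumset-complete A b∈A b+x∈A))) x∉A+A
... | true | false = refl
... | false | true = refl
... | false | false = refl

module Density {n : ℕ} (A V : SubsetG n) where

  T : SubsetG n
  T = V ∖ sumset A

  a t N : ℤ
  a = + card A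
  t = + card T
  N = ∣G∣ n

  w : G n → ℤ
  w γ = hat (𝟙 A) γ * hat (𝟙 A) γ

  T̂ : G n → ℤ
  T̂ = hat (𝟙 T)

  -- off⊥ γ holds iff γ ∉ V⊥, i.e. γ·v = 1 for some v ∈ V.
  off⊥ : G n → Bool
  off⊥ γ = anyL (λ v → V v ∧ (γ · v)) (allG n)

  on⊥ : G n → Bool
  on⊥ γ = not (off⊥ γ)

  -- deficit γ ≤ 0 is what yields the density increment on V ∩ γ⊥.
  deficit : G n → ℤ
  deficit γ = T̂ γ * (N - a) + t * a

  Z : ℤ
  Z = ∑ (restrict on⊥ w)

  w-nonneg : ∀ γ → 0ℤ ≤ w γ
  w-nonneg γ = square-nonneg (hat (𝟙 A) γ)

  off⊥-intro : ∀ γ {v} → v ∈ V → γ · v ≡ true → off⊥ γ ≡ true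
  off⊥-intro γ {v} v∈V γv = anyL-complete _ (allG-complete v) (cong₂ _∧_ v∈V γv)

  off⊥-witness : ∀ γ → off⊥ γ ≡ true → Σ (G n) λ v → v ∈ V × γ · v ≡ true
  off⊥-witness γ found = let (v , p) = anyL-sound _ (allG n) found in v , ∧-elim p

  on⊥-orthogonal : ∀ γ {v} → off⊥ γ ≡ false → v ∈ V → γ · v ≡ false
  on⊥-orthogonal γ {v} none v∈V = trans (cong (_∧ (γ · v)) (sym v∈V)) (anyL-false _ none v)

  0G-on⊥ : off⊥ 0G ≡ false
  0G-on⊥ = anyL-none _ (allG n) (λ v → trans (cong (V v ∧_) (·-0ˡ v)) (∧-zeroʳ (V v)))

  T̂-bounds : ∀ γ → (- t ≤ T̂ γ) × (T̂ γ ≤ t)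
  T̂-bounds γ rewrite card-∑ T = hat-bounds (𝟙-nonneg T) γ

  -- T avoids A + A, so T is uncorrelated with 1_A * 1_A.
  correlation-vanishes : ∑ (λ γ → T̂ γ * w γ) ≡ 0ℤ
  correlation-vanishes = begin
    ∑ (λ γ → T̂ γ * w γ)                                         ≡⟨ convolution-identity (𝟙 T) (𝟙 A) ⟩
    ∑ (λ x → 𝟙 T x * (N * ∑ (λ b → 𝟙 A (b ⊕ x) * 𝟙 A b)))      ≡⟨ ∑-cong pointwise ⟩
    ∑ {n} (λ _ → 0ℤ)                                            ≡⟨ ∑-zero {n} ⟩
    0ℤ                                                          ∎
    where
    guarded : ∀ b s {r} → (s ≡ false → r ≡ 0ℤ) → ι (b ∧ not s) * r ≡ 0ℤ
    guarded false s {r} _ = *-zeroˡ r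
    guarded true true {r} _ = *-zeroˡ r
    guarded true false {r} r≡0 = trans (*-identityˡ r) (r≡0 refl)

    pointwise : ∀ x → 𝟙 T x * (N * ∑ (λ b → 𝟙 A (b ⊕ x) * 𝟙 A b)) ≡ 0ℤ
    pointwise x = guarded (V x) (sumset A x) λ x∉A+A →
      trans (cong (N *_) (trans (∑-cong (no-representation A x∉A+A)) (∑-zero {n}))) (*-zeroʳ N)

  weight-total : ∑ w ≡ N * a
  weight-total =
    trans (parseval (𝟙 A) (𝟙 A)) (cong (N *_) (trans (∑-cong (λ x → ι-idem (A x))) (sym (card-∑ A))))

  -- On V⊥ the characters are constant on T, so T̂ = t there.
  T̂-on⊥ : ∀ γ → off⊥ γ ≡ false → T̂ γ ≡ t
  T̂-on⊥ γ none = trans (∑-cong pointwise) (sym (card-∑ T))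
    where
    pointwise : ∀ x → 𝟙 T x * χ γ x ≡ 𝟙 T x
    pointwise x = by-membership (V x) refl
      where
      by-membership : ∀ b → V x ≡ b → ι (b ∧ not (sumset A x)) * χ γ x ≡ ι (b ∧ not (sumset A x))
      by-membership false _ = *-zeroˡ (χ γ x)
      by-membership true x∈V =
        trans (cong (λ d → ι (not (sumset A x)) * (if d then -1ℤ else 1ℤ)) (on⊥-orthogonal γ none x∈V))
              (*-identityʳ (ι (not (sumset A x))))

  -- V⊥ ∋ 0 carries at least the weight w(0) = Â(0)² = a².
  a²≤Z : a * a ≤ Z
  a²≤Z = subst (_≤ Z) at-zero (∑-term (restrict-nonneg on⊥ w-nonneg) 0G)
    where
    Â0 : hat (𝟙 A) 0G ≡ a
    Â0 = trans (hat-0 (𝟙 A)) (sym (card-∑ A))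

    at-zero : restrict on⊥ w 0G ≡ a * a
    at-zero rewrite 0G-on⊥ = cong₂ _*_ Â0 Â0

  off⊥-weight : ∑ (restrict off⊥ w) ≡ N * a - Z
  off⊥-weight = move-right (trans (sym weight-total) (∑-split off⊥ w))

  off⊥-correlation : ∑ (restrict off⊥ (λ γ → T̂ γ * w γ)) ≡ - (t * Z)
  off⊥-correlation = trans (move-right total) (+-identityˡ (- (t * Z)))
    where
    pointwise : ∀ γ → restrict on⊥ (λ γ → T̂ γ * w γ) γ ≡ t * restrict on⊥ w γ
    pointwise γ with off⊥ γ in e
    ... | true = sym (*-zeroʳ t)
    ... | false = cong (_* w γ) (T̂-on⊥ γ e)

    total : 0ℤ ≡ ∑ (restrict off⊥ (λ γ → T̂ γ * w γ)) + t * Z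
    total = begin
      0ℤ                   ≡⟨ correlation-vanishes ⟨
      ∑ (λ γ → T̂ γ * w γ)  ≡⟨ ∑-split off⊥ (λ γ → T̂ γ * w γ) ⟩
      ∑ (restrict off⊥ (λ γ → T̂ γ * w γ)) + ∑ (restrict on⊥ (λ γ → T̂ γ * w γ))
        ≡⟨ cong (λ s → ∑ (restrict off⊥ (λ γ → T̂ γ * w γ)) + s)
                (trans (∑-cong pointwise) (∑-*ˡ t (restrict on⊥ w))) ⟩
      ∑ (restrict off⊥ (λ γ → T̂ γ * w γ)) + t * Z ∎

  -- Off V⊥, the w-weighted deficit sums to t N (a² - Z) ≤ 0.
  weighted-deficit : ∑ (λ γ → restrict off⊥ w γ * deficit γ) ≤ 0ℤ
  weighted-deficit = subst (_≤ 0ℤ) (sym evaluate) nonneg×nonpos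
    where
    Tw : G n → ℤ
    Tw γ = T̂ γ * w γ

    expand : ∀ γ → restrict off⊥ w γ * deficit γ ≡ (N - a) * restrict off⊥ Tw γ + (t * a) * restrict off⊥ w γ
    expand γ with off⊥ γ
    ... | true = on-support (w γ) (T̂ γ) (N - a) (t * a)
      where
      on-support : ∀ u h k m → u * (h * k + m) ≡ k * (h * u) + m * u
      on-support = solve-∀
    ... | false = off-support (deficit γ) (N - a) (t * a)
      where
      off-support : ∀ d k m → 0ℤ * d ≡ k * 0ℤ + m * 0ℤ
      off-support = solve-∀

    simplify : ∀ N a t Z → (N - a) * - (t * Z) + (t * a) * (N * a - Z) ≡ (t * N) * (a * a - Z)
    simplify = solve-∀

    evaluate : ∑ (λ γ → restrict off⊥ w γ * deficit γ) ≡ (t * N) * (a * a - Z)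
    evaluate = begin
      ∑ (λ γ → restrict off⊥ w γ * deficit γ)
        ≡⟨ ∑-cong expand ⟩
      ∑ (λ γ → (N - a) * restrict off⊥ Tw γ + (t * a) * restrict off⊥ w γ)
        ≡⟨ ∑-+ (λ γ → (N - a) * restrict off⊥ Tw γ) (λ γ → (t * a) * restrict off⊥ w γ) ⟩
      ∑ (λ γ → (N - a) * restrict off⊥ Tw γ) + ∑ (λ γ → (t * a) * restrict off⊥ w γ)
        ≡⟨ cong₂ _+_ (∑-*ˡ (N - a) (restrict off⊥ Tw)) (∑-*ˡ (t * a) (restrict off⊥ w)) ⟩
      (N - a) * ∑ (restrict off⊥ Tw) + (t * a) * ∑ (restrict off⊥ w)
        ≡⟨ cong₂ (λ p q → (N - a) * p + (t * a) * q) off⊥-correlation off⊥-weight ⟩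
      (N - a) * - (t * Z) + (t * a) * (N * a - Z)
        ≡⟨ simplify N a t Z ⟩
      (t * N) * (a * a - Z) ∎

    nonneg×nonpos : (t * N) * (a * a - Z) ≤ 0ℤ
    nonneg×nonpos = subst ((t * N) * (a * a - Z) ≤_) (*-zeroʳ (t * N))
      (*-monoˡ-≤-nonNeg (t * N) {{nonNegative (*-nonneg {t} {N} (+≤+ z≤n) (+≤+ z≤n))}} (i≤j⇒i-j≤0 a²≤Z))

  -- If A and T are non-empty, the weight off V⊥ is positive: by |T̂| ≤ t,
  -- t Σ_{off V⊥} w ≥ - Σ_{off V⊥} T̂ w = t Z ≥ t a² > 0.
  off⊥-weight-positive : card A > 0 → card T > 0 → 0ℤ < ∑ (restrict off⊥ w)
  off⊥-weight-positive |A|>0 |T|>0 =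
    <-≤-trans a²>0 (≤-trans a²≤Z (*-cancelˡ-≤-pos Z Y t {{positive (+<+ |T|>0)}} tZ≤tY))
    where
    Y : ℤ
    Y = ∑ (restrict off⊥ w)

    pointwise : ∀ γ → - t * restrict off⊥ w γ ≤ restrict off⊥ (λ γ → T̂ γ * w γ) γ
    pointwise γ with off⊥ γ
    ... | true = *-monoʳ-≤-nonNeg (w γ) {{nonNegative (w-nonneg γ)}} (proj₁ (T̂-bounds γ))
    ... | false = ≤-reflexive (*-zeroʳ (- t))

    tZ≤tY : t * Z ≤ t * Y
    tZ≤tY = neg-cancel-≤ (subst₂ _≤_ scaled off⊥-correlation (∑-mono pointwise))
      where
      scaled : ∑ (λ γ → - t * restrict off⊥ w γ) ≡ - (t * Y)
      scaled = trans (∑-*ˡ (- t) (restrict off⊥ w)) (sym (neg-distribˡ-* t Y))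

    a²>0 : 0ℤ < a * a
    a²>0 = subst (_< a * a) (*-zeroʳ a) (*-monoˡ-<-pos a {{positive (+<+ |A|>0)}} (+<+ |A|>0))

  -- The key step: some γ ∉ V⊥ has non-positive deficit.  If T = ∅ every
  -- deficit vanishes; otherwise average the deficit against w off V⊥.
  good-character : card A > 0 → ∀ γ₀ → off⊥ γ₀ ≡ true →
    Σ (G n) λ γ → (off⊥ γ ≡ true) × (deficit γ ≤ 0ℤ)
  good-character |A|>0 γ₀ γ₀∉V⊥ with card T ℕ.≟ 0
  ... | yes |T|≡0 = γ₀ , γ₀∉V⊥ , ≤-reflexive deficit≡0
    where
    t≡0 : t ≡ 0ℤ
    t≡0 = cong +_ |T|≡0

    T̂≡0 : T̂ γ₀ ≡ 0ℤ
    T̂≡0 = let (lower , upper) = T̂-bounds γ₀ in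
      ≤-antisym (subst (T̂ γ₀ ≤_) t≡0 upper) (subst (λ s → - s ≤ T̂ γ₀) t≡0 lower)

    deficit≡0 : deficit γ₀ ≡ 0ℤ
    deficit≡0 = begin
      T̂ γ₀ * (N - a) + t * a  ≡⟨ cong₂ (λ p q → p * (N - a) + q * a) T̂≡0 t≡0 ⟩
      0ℤ * (N - a) + 0ℤ * a   ≡⟨ cong₂ _+_ (*-zeroˡ (N - a)) (*-zeroˡ a) ⟩
      0ℤ                      ∎
  ... | no |T|≢0 =
    let (γ , w>0 , deficit≤0) = ∑-averaging (restrict off⊥ w) deficit (restrict-nonneg off⊥ w-nonneg)
          (≤-<-trans weighted-deficit (off⊥-weight-positive |A|>0 (ℕ.n≢0⇒n>0 |T|≢0)))
    in γ , restrict-support off⊥ {w} {γ} w>0 , deficit≤0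

  t′ : G n → ℤ
  t′ γ = + card (hyperplane V γ ∖ sumset A)

  T-halving : ∀ γ → t′ γ + t′ γ ≡ t + T̂ γ
  T-halving γ = trans (cong (λ k → k + k) (card-cong reorder)) (hyperplane-count T γ)
    where
    reorder : ∀ x → (hyperplane V γ ∖ sumset A) x ≡ hyperplane T γ x
    reorder x = begin
      (V x ∧ not (γ · x)) ∧ not (sumset A x)  ≡⟨ ∧-assoc (V x) _ _ ⟩
      V x ∧ (not (γ · x) ∧ not (sumset A x))  ≡⟨ cong (V x ∧_) (∧-comm (not (γ · x)) _) ⟩
      V x ∧ (not (sumset A x) ∧ not (γ · x))  ≡⟨ ∧-assoc (V x) _ _ ⟨
      (V x ∧ not (sumset A x)) ∧ not (γ · x)  ∎

ratio-bound : ∀ (N a t c h : ℤ) {v v′ : ℤ} → c + c ≡ t + h → h * (N - a) + t * a ≤ 0ℤ →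
  v ≡ v′ + v′ → 0ℤ ≤ v′ → c * v * (N - a) ≤ (N - (+ 2) * a) * t * v′
ratio-bound N a t c h {v} {v′} halving deficit≤0 v≡2v′ v′≥0 =
  subst₂ _≤_ (sym lhs) (expand N a t h v′)
    (i≤i+j _ _ {{nonNegative (*-nonneg v′≥0 (neg-mono-≤ deficit≤0))}})
  where
  double : ∀ c v k → c * (v + v) * k ≡ (c + c) * v * k
  double = solve-∀

  expand : ∀ N a t h v → (t + h) * v * (N - a) + v * - (h * (N - a) + t * a) ≡ (N - (+ 2) * a) * t * v
  expand = solve-∀

  lhs : c * v * (N - a) ≡ (t + h) * v′ * (N - a)
  lhs = begin
    c * v * (N - a)          ≡⟨ cong (λ u → c * u * (N - a)) v≡2v′ ⟩
    c * (v′ + v′) * (N - a)  ≡⟨ double c v′ (N - a) ⟩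
    (c + c) * v′ * (N - a)   ≡⟨ cong (λ u → u * v′ * (N - a)) halving ⟩
    (t + h) * v′ * (N - a)   ∎

lemma4p2 : (n : ℕ) → n ≥ 1 → (A : SubsetG n) → card A > 0 →
    (V : SubsetG n) → IsSubspace V → NonZero V →
    Σ (SubsetG n) λ V' → CodimOneIn V' V ×
      ((+ card (V' ∖ sumset A)) * (+ card V) * (+ (2 ^ n) - + card A)
        ≤ (+ (2 ^ n) - (+ 2) * (+ card A)) * (+ card (V ∖ sumset A)) * (+ card V'))
lemma4p2 n _ A |A|>0 V V-sub (v₀ , v₀∈V , v₀≢0) =
  let open Density A V
      (γ₀ , γ₀v₀) = nonzero-detected (toWitnessFalse v₀≢0)
      (γ , γ∉V⊥ , deficit≤0) = good-character |A|>0 γ₀ (off⊥-intro γ₀ v₀∈V γ₀v₀)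
      (v , v∈V , γv) = off⊥-witness γ γ∉V⊥
  in hyperplane V γ , hyperplane-codim {γ = γ} V-sub v∈V γv ,
     ratio-bound N a t (t′ γ) (T̂ γ) (T-halving γ) deficit≤0
                 (hyperplane-halves γ V-sub v∈V γv) (+≤+ z≤n)
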